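{- Let $d$ be a positive integer, let $X$ be a set of vertices in a graph $G$, and let $C(X)$ be the $d$-critical set of $X$. Suppose $B$ is an escape-way in $G$ with $V_{\text{out}}(B) \subset C(X)$. Then $|A_{K(B)}(v)| \geq \deg_G(v) - d$ for every vertex $v \notin C(X)$.
   Context: The $d$-critical set $C(X)$ of $X\subset V(G)$ is the terminal set of the following bootstrap percolation: $X_0 = X$, and $X_{i+1}$ is the union of $X_i$ with all vertices $v$ that have at least $d$ neighbours which are at distance at most $2$ from $X_i$ in the graph $G\setminus v$ (vertices of $X_i$ have distance $0$); $C(X)=\bigcup_i X_i$. For a digraph $D$ write $N^-_D(v)=\{u: uv\in E(D)\}$; $V_{\text{in}}(D)$ (resp. $V_{\text{out}}(D)$) is the set of vertices with at least one in-neighbour (resp. out-neighbour) in $D$, and $D-v$ denotes $D$ with $v$ deleted. An escape-way in $G$ is an oriented subgraph $D$ of $G$ (viewed as a digraph on $V(G)$) such that every vertex has in-degree at most $1$ in $D$, and whenever $x,y\in V_{\text{in}}(D)$ and $xy\in E(G)$, exactly one of $xy$, $yx$ is in $E(D)$. For an oriented subgraph $D$ and $v\in V(G)$, $A_D(v) = N_G(v)\setminus\big(V_{\text{in}}(D-v)\cup N^-_D(v)\big)$. $K(D)$ is obtained from $D$ by adding, for every edge $uv\in E(D)$ oriented from $u$ to $v$, all edges oriented from $v$ to $w$ for $w\in N_G(v)\setminus\{u\}$. -}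

module Defs where

open import Data.Nat using (ℕ; suc; _≤_; _≤ᵇ_)
open import Data.Bool using (Bool; true; false; _∧_; _∨_; not; _xor_)
open import Data.Fin using (Fin; _≟_)
open import Data.List using (List; allFin; filter; length)
open import Data.Bool.ListAction using (any)
open import Data.Bool using (T?)
open import Data.Product using (∃)
open import Relation.Nullary.Decidable using (⌊_⌋)
open import Relation.Binary.PropositionalEquality using (_≡_)

record Graph (n : ℕ) : Set where
  field
    adj     : Fin n → Fin n → Bool
    symm    : ∀ u v → adj u v ≡ adj v u
    irrefl  : ∀ v → adj v v ≡ false
open Graph public

VSet : ℕ → Set
VSet n = Fin n → Bool

-- Digraphs (oriented graphs) on Fin n: D u v = true means the arc u → v.
Digraph : ℕ → Set
Digraph n = Fin n → Fin n → Bool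

card : ∀ {n} → VSet n → ℕ
card {n} P = length (filter (λ v → T? (P v)) (allFin n))

anyV : ∀ {n} → VSet n → Bool
anyV {n} P = any P (allFin n)

neq : ∀ {n} → Fin n → Fin n → Bool
neq x y = not ⌊ x ≟ y ⌋

N : ∀ {n} → Graph n → Fin n → VSet n
N G v = adj G v

deg : ∀ {n} → Graph n → Fin n → ℕ
deg G v = card (N G v)

-- u is at distance at most 2 from S in the graph G \ v  (u ≠ v assumed)
near : ∀ {n} → Graph n → VSet n → Fin n → Fin n → Bool
near G S v u =
  S u
  ∨ anyV (λ x → S x ∧ neq x v ∧ adj G u x)
  ∨ anyV (λ y → neq y v ∧ adj G u y ∧ anyV (λ x → S x ∧ neq x v ∧ adj G y x))

step : ∀ {n} → ℕ → Graph n → VSet n → VSet n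
step d G S v = S v ∨ (d ≤ᵇ card (λ u → adj G v u ∧ near G S v u))

iter : ∀ {n} → ℕ → Graph n → VSet n → ℕ → VSet n
iter d G X 0       = X
iter d G X (suc i) = step d G (iter d G X i)

InC : ∀ {n} → ℕ → Graph n → VSet n → Fin n → Set
InC d G X v = ∃ λ i → iter d G X i v ≡ true

Vin : ∀ {n} → Digraph n → VSet n
Vin D v = anyV (λ u → D u v)

Vout : ∀ {n} → Digraph n → VSet n
Vout D v = anyV (λ w → D v w)

Nin : ∀ {n} → Digraph n → Fin n → VSet n
Nin D v u = D u v

delV : ∀ {n} → Digraph n → Fin n → Digraph n
delV D v x y = neq x v ∧ neq y v ∧ D x y

A : ∀ {n} → Graph n → Digraph n → Fin n → VSet n
A G D v u = adj G v u ∧ not (Vin (delV D v) u) ∧ not (Nin D v u)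

K : ∀ {n} → Graph n → Digraph n → Digraph n
K G D v w = D v w ∨ anyV (λ u → D u v ∧ adj G v w ∧ neq w u)

record Oriented {n} (G : Graph n) (D : Digraph n) : Set where
  field
    sub  : ∀ u v → D u v ≡ true → adj G u v ≡ true
    anti : ∀ u v → D u v ≡ true → D v u ≡ false
open Oriented public

record EscapeWay {n} (G : Graph n) (D : Digraph n) : Set where
  field
    oriented : Oriented G D
    indeg≤1  : ∀ v → card (Nin D v) ≤ 1
    tourn    : ∀ x y → Vin D x ≡ true → Vin D y ≡ true → adj G x y ≡ true →
               (D x y xor D y x) ≡ true
open EscapeWay public

{-# OPTIONS --safe #-}
module Submission where

-- Take a stage S = X_I of the percolation that already contains V_out(B).
-- A neighbour u of v that is not in A_{K(B)}(v) receives an arc of K(B)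
-- from some x ≠ v or sends one to v; unfolding K, such an arc comes from an
-- arc of B, whose tail lies in S, so u is at distance at most 2 from S in
-- G \ v. Since v is never added to C(X), fewer than d neighbours of v are
-- that close to S, and all the others lie in A_{K(B)}(v).

open import Defs
open import Data.Nat using (ℕ; suc; _≤_; _<_; _∸_; _+_; _⊔_; _≤′_; z≤n; s≤s; ≤′-refl; ≤′-step)
open import Data.Nat.Properties using (≤-trans; <⇒≤; ≰⇒>; ≤⇒≤ᵇ; ≤⇒≤′; m≤n⇒m≤1+n; +-suc; +-monoˡ-≤; +-monoʳ-≤; n≤1+n; ≤-reflexive; m≤m⊔n; m≤n⊔m; m≤n+o⇒m∸n≤o)
open import Data.Fin using (Fin; _≟_)
open import Data.Bool using (Bool; true; false; _∧_; _∨_; T; T?)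
open import Data.Bool.Properties using (T-≡; ¬-not; ∨-conicalʳ)
open import Data.List using (List; []; _∷_; allFin; filter; length)
open import Data.List.Relation.Unary.All as All using (All; []; _∷_)
open import Data.List.Relation.Unary.Any using (satisfied)
open import Data.List.Relation.Unary.Any.Properties using (any⁺; any⁻)
open import Data.List.Membership.Propositional using (lose)
open import Data.List.Membership.Propositional.Properties using (∈-allFin)
open import Data.Product using (∃; _,_; _×_; proj₁; proj₂)
import Data.Product as Product
open import Data.Sum using (_⊎_; inj₁; inj₂)
open import Function using (Equivalence)
open import Relation.Nullary using (¬_; yes; no; contradiction)
open import Relation.Binary.PropositionalEquality using (_≡_; refl; sym; trans; subst)

open Equivalence using (to; from)

∧-true⁺ : ∀ {a b} → a ≡ true → b ≡ true → a ∧ b ≡ true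
∧-true⁺ refl refl = refl

∧-true⁻ : ∀ {a b} → a ∧ b ≡ true → a ≡ true × b ≡ true
∧-true⁻ {true} {true} refl = refl , refl

∨-true⁺ˡ : ∀ {a b} → a ≡ true → a ∨ b ≡ true
∨-true⁺ˡ refl = refl

∨-true⁺ʳ : ∀ {a b} → b ≡ true → a ∨ b ≡ true
∨-true⁺ʳ {true}  _ = refl
∨-true⁺ʳ {false} p = p

∨-true⁻ : ∀ {a b} → a ∨ b ≡ true → a ≡ true ⊎ b ≡ true
∨-true⁻ {true}  refl = inj₁ refl
∨-true⁻ {false} p    = inj₂ p

neq-true : ∀ {n} {x y : Fin n} → ¬ x ≡ y → neq x y ≡ true
neq-true {x = x} {y} x≢y with x ≟ y
... | yes x≡y = contradiction x≡y x≢y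
... | no  _   = refl

anyV-true⁺ : ∀ {n} (P : VSet n) x → P x ≡ true → anyV P ≡ true
anyV-true⁺ P x px = to T-≡ (any⁺ P (lose (∈-allFin x) (from T-≡ px)))

anyV-true⁻ : ∀ {n} (P : VSet n) → anyV P ≡ true → ∃ λ x → P x ≡ true
anyV-true⁻ {n} P e = Product.map₂ (to T-≡) (satisfied (any⁻ P (allFin n) (from T-≡ e)))

module _ {A : Set} where

  count : (A → Bool) → List A → ℕ
  count P xs = length (filter (λ x → T? (P x)) xs)

  count-mono : ∀ {P Q : A → Bool} → (∀ x → P x ≡ true → Q x ≡ true) →
               ∀ xs → count P xs ≤ count Q xs
  count-mono h [] = z≤n
  count-mono {P} {Q} h (x ∷ xs) with P x in px | Q x in qx
  ... | false | false = count-mono h xs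
  ... | false | true  = m≤n⇒m≤1+n (count-mono h xs)
  ... | true  | true  = s≤s (count-mono h xs)
  ... | true  | false = contradiction (trans (sym (h x px)) qx) λ ()

  count-∨ : ∀ (Q R : A → Bool) xs → count (λ x → Q x ∨ R x) xs ≤ count Q xs + count R xs
  count-∨ Q R [] = z≤n
  count-∨ Q R (x ∷ xs) with Q x | R x | count-∨ Q R xs
  ... | true  | true  | ih = s≤s (≤-trans ih (+-monoʳ-≤ (count Q xs) (n≤1+n (count R xs))))
  ... | true  | false | ih = s≤s ih
  ... | false | true  | ih = ≤-trans (s≤s ih) (≤-reflexive (sym (+-suc (count Q xs) (count R xs))))
  ... | false | false | ih = ih

  count-cover : ∀ {P Q R : A → Bool} → (∀ x → P x ≡ true → Q x ∨ R x ≡ true) →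
                ∀ xs → count P xs ≤ count Q xs + count R xs
  count-cover {Q = Q} {R} h xs = ≤-trans (count-mono h xs) (count-∨ Q R xs)

module _ {n} (d : ℕ) (G : Graph n) (X : VSet n) where

  iter-mono : ∀ {i j} → i ≤ j → ∀ {w} → iter d G X i w ≡ true → iter d G X j w ≡ true
  iter-mono i≤j = go (≤⇒≤′ i≤j)
    where
    go : ∀ {i j} → i ≤′ j → ∀ {w} → iter d G X i w ≡ true → iter d G X j w ≡ true
    go ≤′-refl        p = p
    go (≤′-step i≤′j) p = ∨-true⁺ˡ (go i≤′j p)

  common-stage : ∀ (P : VSet n) → (∀ v → P v ≡ true → InC d G X v) → ∀ xs →
                 ∃ λ I → All (λ v → P v ≡ true → iter d G X I v ≡ true) xs
  common-stage P P⊆C [] = 0 , []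
  common-stage P P⊆C (x ∷ xs) with P x in px | common-stage P P⊆C xs
  ... | false | I , later = I , (λ x∈P → contradiction (trans (sym x∈P) px) λ ()) ∷ later
  ... | true  | I , later with P⊆C x px
  ... | i , x∈Xᵢ =
    i ⊔ I , (λ _ → iter-mono (m≤m⊔n i I) x∈Xᵢ) ∷ All.map (λ q p → iter-mono (m≤n⊔m i I) (q p)) later

  InC⇒stage : ∀ (P : VSet n) → (∀ v → P v ≡ true → InC d G X v) →
              ∃ λ I → ∀ v → P v ≡ true → iter d G X I v ≡ true
  InC⇒stage P P⊆C with common-stage P P⊆C (allFin n)
  ... | I , all = I , λ v → All.lookup all (∈-allFin v)

  ¬InC⇒iter-false : ∀ {v} → ¬ InC d G X v → ∀ i → iter d G X i v ≡ false
  ¬InC⇒iter-false v∉C i = ¬-not λ v∈Xᵢ → v∉C (i , v∈Xᵢ)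

nearNeighbours : ∀ {n} → Graph n → VSet n → Fin n → VSet n
nearNeighbours G S v u = adj G v u ∧ near G S v u

step-false⇒few-near : ∀ {n} d (G : Graph n) S v → step d G S v ≡ false →
                      card (nearNeighbours G S v) < d
step-false⇒few-near d G S v notAdded = ≰⇒> λ d≤c →
  subst T (∨-conicalʳ (S v) _ notAdded) (≤⇒≤ᵇ d≤c)

adj-sym : ∀ {n} (G : Graph n) {u v} → adj G u v ≡ true → adj G v u ≡ true
adj-sym G {u} {v} p = trans (symm G v u) p

module _ {n} (G : Graph n) (B : Digraph n) (S : VSet n) (v : Fin n)
         (B⊆G : ∀ a b → B a b ≡ true → adj G a b ≡ true)
         (Vout⊆S : ∀ w → Vout B w ≡ true → S w ≡ true)
         (v∉S : S v ≡ false) where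

  S-avoids : ∀ {w} → S w ≡ true → neq w v ≡ true
  S-avoids w∈S = neq-true λ { refl → contradiction (trans (sym w∈S) v∉S) λ () }

  tail∈S : ∀ {a b} → B a b ≡ true → S a ≡ true
  tail∈S {a} {b} ab = Vout⊆S a (anyV-true⁺ (B a) b ab)

  near-dist₁ : ∀ {u x} → S x ≡ true → adj G u x ≡ true → near G S v u ≡ true
  near-dist₁ {u} {x} x∈S ux = ∨-true⁺ʳ {S u} (∨-true⁺ˡ
    (anyV-true⁺ (λ x → S x ∧ neq x v ∧ adj G u x) x (∧-true⁺ x∈S (∧-true⁺ (S-avoids x∈S) ux))))

  near-dist₂ : ∀ {u y x} → S x ≡ true → adj G y x ≡ true → neq y v ≡ true → adj G u y ≡ true →
          near G S v u ≡ true
  near-dist₂ {u} {y} {x} x∈S yx y≢v uy = ∨-true⁺ʳ {S u} (∨-true⁺ʳ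
    (anyV-true⁺ (λ y → neq y v ∧ adj G u y ∧ anyV (λ x → S x ∧ neq x v ∧ adj G y x)) y
      (∧-true⁺ y≢v (∧-true⁺ uy
        (anyV-true⁺ (λ x → S x ∧ neq x v ∧ adj G y x) x (∧-true⁺ x∈S (∧-true⁺ (S-avoids x∈S) yx)))))))

  head-near : ∀ {a b} → B a b ≡ true → near G S v b ≡ true
  head-near ab = near-dist₁ (tail∈S ab) (adj-sym G (B⊆G _ _ ab))

  K-head-near : ∀ {x u} → K G B x u ≡ true → neq x v ≡ true → near G S v u ≡ true
  K-head-near {x} {u} xu x≢v with ∨-true⁻ {B x u} xu
  ... | inj₁ Bxu = head-near Bxu
  ... | inj₂ viaB with anyV-true⁻ (λ w → B w x ∧ adj G x u ∧ neq u w) viaB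
  ... | w , wxu with ∧-true⁻ {B w x} wxu
  ... | wx , xu′ = near-dist₂ (tail∈S wx) (adj-sym G (B⊆G _ _ wx)) x≢v (adj-sym G (proj₁ (∧-true⁻ xu′)))

  K-tail-near : ∀ {u} → K G B u v ≡ true → near G S v u ≡ true
  K-tail-near {u} uv with ∨-true⁻ {B u v} uv
  ... | inj₁ Buv = ∨-true⁺ˡ (tail∈S Buv)
  ... | inj₂ viaB with anyV-true⁻ (λ w → B w u ∧ adj G u v ∧ neq v w) viaB
  ... | w , wuv = head-near (proj₁ (∧-true⁻ wuv))

  neighbour-near-or-A : ∀ u → adj G v u ≡ true →
                        nearNeighbours G S v u ∨ A G (K G B) v u ≡ true
  neighbour-near-or-A u vu with Vin (delV (K G B) v) u in entering | K G B u v in toV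
  ... | false | false = ∨-true⁺ʳ (∧-true⁺ vu refl)
  ... | false | true  = ∨-true⁺ˡ (∧-true⁺ vu (K-tail-near toV))
  ... | true  | _ with anyV-true⁻ (λ x → neq x v ∧ neq u v ∧ K G B x u) entering
  ... | x , xu with ∧-true⁻ {neq x v} xu
  ... | x≢v , rest = ∨-true⁺ˡ (∧-true⁺ vu (K-head-near (proj₂ (∧-true⁻ rest)) x≢v))

  deg≤near+A : deg G v ≤ card (nearNeighbours G S v) + card (A G (K G B) v)
  deg≤near+A = count-cover neighbour-near-or-A (allFin n)

proposition2p8 : ∀ {n} (d : ℕ) → 1 ≤ d → (G : Graph n) (X : VSet n) (B : Digraph n) →
    EscapeWay G B → (∀ v → Vout B v ≡ true → InC d G X v) →
    ∀ v → ¬ InC d G X v → deg G v ∸ d ≤ card (A G (K G B) v)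
proposition2p8 {n} d _ G X B escape Vout⊆C v v∉C =
  m≤n+o⇒m∸n≤o (deg G v) d (≤-trans deg-bound (+-monoˡ-≤ (card (A G (K G B) v)) (<⇒≤ few-near)))
  where
  stage : ∃ λ I → ∀ w → Vout B w ≡ true → iter d G X I w ≡ true
  stage = InC⇒stage d G X (Vout B) Vout⊆C

  S : VSet n
  S = iter d G X (proj₁ stage)

  deg-bound : deg G v ≤ card (nearNeighbours G S v) + card (A G (K G B) v)
  deg-bound = deg≤near+A G B S v (sub (oriented escape)) (proj₂ stage)
                (¬InC⇒iter-false d G X v∉C (proj₁ stage))

  few-near : card (nearNeighbours G S v) < d
  few-near = step-false⇒few-near d G S v (¬InC⇒iter-false d G X v∉C (suc (proj₁ stage)))
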